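{- Let $\mathcal N=(D,s,t)$ be a network with $D=(V,E)$ a finite directed graph, and write $V^\circ=V\setminus\{s,t\}$. Let $\mathcal P_1,\ldots,\mathcal P_m$ be sets of $s$–$t$ paths in $D$ such that, for each $i$, the paths in $\mathcal P_i$ are pairwise innerly disjoint, let $\mathcal P$ be the multiset union $\mathcal P_1\cup\cdots\cup\mathcal P_m$, and let $\mathcal L=(\mathcal P_1,\ldots,\mathcal P_m)$. If $|\mathcal P|>|V^\circ|$, then $t\in R(\mathcal L)$, i.e. there exists an $\mathcal L$-multicolored $s$–$t$ path.
   Context: A network is a triple $(D,s,t)$ where $D=(V,E)$ is a directed graph and $s,t\in V$ are distinct vertices such that no edge of $D$ enters $s$ and no edge leaves $t$. Paths are directed paths without repeated vertices. For an $s$–$t$ path $P$, $V^\circ(P)=V(P)\setminus\{s,t\}$; two $s$–$t$ paths $P,Q$ are innerly disjoint if $V^\circ(P)\cap V^\circ(Q)=\emptyset$. For a set $\mathcal P_i$ of paths, $E[\mathcal P_i]$ is the union of their edge sets. A path $Q$ is $\mathcal L$-multicolored if there is an injective map $\psi:E(Q)\to\{1,\ldots,m\}$ with $e\in E[\mathcal P_{\psi(e)}]$ for all $e\in E(Q)$. $R(\mathcal L)$ is the set of vertices $v$ for which there is an $\mathcal L$-multicolored path from $s$ to $v$. -}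

module Defs where

open import Data.Nat using (ℕ; _∸_; _<_)
open import Data.Fin using (Fin)
open import Data.List using (List; []; _∷_; _++_; length; map)
open import Data.Nat.ListAction using (sum)
open import Data.List.Membership.Propositional using (_∈_)
open import Data.List.Relation.Unary.All using (All)
open import Data.List.Relation.Unary.Unique.Propositional using (Unique)
open import Data.List.Relation.Unary.AllPairs using (AllPairs)
open import Data.Product using (_×_; _,_; Σ; ∃)
open import Data.Empty using (⊥)
open import Relation.Nullary using (¬_)
open import Relation.Binary.PropositionalEquality using (_≡_; _≢_)
open import Function.Definitions using (Injective)

record Network : Set₁ where
  field
    n     : ℕ
    E     : Fin n → Fin n → Set
    s t   : Fin n
    s≢t   : s ≢ t
    noIn  : ∀ u → ¬ E u s
    noOut : ∀ v → ¬ E t v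

pairs : {A : Set} → List A → List (A × A)
pairs []            = []
pairs (x ∷ [])      = []
pairs (x ∷ y ∷ xs)  = (x , y) ∷ pairs (y ∷ xs)

module _ (N : Network) where
  open Network N

  V : Set
  V = Fin n

  record STPath : Set where
    constructor stpath
    field
      inner   : List V
      unique  : Unique (s ∷ inner ++ t ∷ [])
      isEdges : All (λ e → E (Data.Product.proj₁ e) (Data.Product.proj₂ e))
                    (pairs (s ∷ inner ++ t ∷ []))

  vertices : STPath → List V
  vertices P = s ∷ STPath.inner P ++ t ∷ []

  edges : STPath → List (V × V)
  edges P = pairs (vertices P)

  InnerlyDisjoint : STPath → STPath → Set
  InnerlyDisjoint P Q = ∀ v → v ∈ STPath.inner P → v ∈ STPath.inner Q → ⊥

  record DisjointFamily : Set where
    field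
      paths    : List STPath
      -- distinct as paths, i.e. as vertex sequences
      distinct : Unique (map STPath.inner paths)
      disjoint : AllPairs InnerlyDisjoint paths

  InEdgeUnion : (V × V) → List STPath → Set
  InEdgeUnion e Ps = Σ STPath λ P → P ∈ Ps × e ∈ edges P

  Multicolored : {m : ℕ} → (Fin m → DisjointFamily) → STPath → Set
  Multicolored {m} L Q =
    Σ (Fin (length (edges Q)) → Fin m) λ ψ →
      Injective _≡_ _≡_ ψ ×
      (∀ j → InEdgeUnion (Data.List.lookup (edges Q) j)
                         (DisjointFamily.paths (L (ψ j))))

  totalSize : {m : ℕ} → (Fin m → DisjointFamily) → ℕ
  totalSize {m} L = sum (map (λ i → length (DisjointFamily.paths (L i)))
                             (Data.List.allFin m))

module Submission where

-- Process the colours one at a time, maintaining a duplicate-free set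
-- S ⊆ V° of reached vertices, each joined to s by a multicoloured path inside
-- S that uses only processed colours, with |S| ≥ |𝒫_1| + ⋯ + |𝒫_k| after k
-- colours.  To process colour c, follow each path P ∈ 𝒫_c from s and stop at
-- the first vertex x ∉ S.  Its predecessor is s or lies in S, so its
-- multicoloured path extends by the edge into x, coloured c.  If x = t we are
-- done; otherwise x is a new inner vertex of P, and as the paths of 𝒫_c are
-- innerly disjoint these new vertices are distinct, so S grows by |𝒫_c|.  If
-- t is never reached, the final S avoids s and t yet has more than n - 2
-- elements, which the pigeonhole principle forbids.

open import Defs
open import Data.Nat using (ℕ; suc; z≤n; _∸_; _<_; _≤_; _≤?_)
open import Data.Nat.Properties using (≰⇒>; <-irrefl; <⇒≱; +-mono-≤; ≤-reflexive; ≤-trans; ∸-monoˡ-≤)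
open import Data.Fin using (Fin; zero; suc; toℕ; cast)
open import Data.Fin.Properties using (pigeonhole; toℕ-injective; toℕ-cast; _≟_)
open import Data.Product using (Σ; ∃; _,_; _×_; proj₁; proj₂)
open import Data.Sum using (_⊎_; inj₁; inj₂)
open import Data.List using (List; []; _∷_; _++_; length; map; lookup; allFin)
open import Data.List.Properties using (length-++)
open import Data.Nat.ListAction using (sum)
open import Data.List.Membership.Propositional using (_∈_; _∉_)
open import Data.List.Membership.Propositional.Properties using (∈-++⁺ˡ; ∈-++⁺ʳ; ∈-++⁻; ∈-lookup)
open import Data.List.Relation.Binary.Subset.Propositional using (_⊆_)
open import Data.List.Relation.Unary.Any using (here; there)
open import Data.List.Relation.Unary.All as All using (All; []; _∷_)
open import Data.List.Relation.Unary.All.Properties as AllP using (¬Any⇒All¬; All¬⇒¬Any)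
open import Data.List.Relation.Unary.AllPairs using (AllPairs; []; _∷_)
open import Data.List.Relation.Unary.Unique.Propositional using (Unique)
import Data.List.Relation.Unary.Unique.Propositional.Properties as UniqueP
open import Data.List.Relation.Binary.Pointwise as Pointwise using (Pointwise; []; _∷_; Pointwise-length)
open import Data.Empty using (⊥-elim)
open import Relation.Nullary using (yes; no)
open import Relation.Binary.PropositionalEquality
open import Function.Definitions using (Injective)

pairs-∷ʳ : {A : Set} (xs : List A) (p x : A) →
  pairs ((xs ++ p ∷ []) ++ x ∷ []) ≡ pairs (xs ++ p ∷ []) ++ (p , x) ∷ []
pairs-∷ʳ []           p x = refl
pairs-∷ʳ (a ∷ [])     p x = refl
pairs-∷ʳ (a ∷ b ∷ xs) p x = cong ((a , b) ∷_) (pairs-∷ʳ (b ∷ xs) p x)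

init≢last : {A : Set} {xs : List A} {x y : A} → Unique (xs ++ y ∷ []) → x ∈ xs → x ≢ y
init≢last (x∉ ∷ _) (here refl) = All.lookup x∉ (∈-++⁺ʳ _ (here refl))
init≢last (_ ∷ u)  (there x∈)  = init≢last u x∈

lookup-injective : {A : Set} {xs : List A} → Unique xs →
  (i j : Fin (length xs)) → lookup xs i ≡ lookup xs j → i ≡ j
lookup-injective (_ ∷ _)  zero    zero    _  = refl
lookup-injective (x∉ ∷ _) zero    (suc j) eq = ⊥-elim (All.lookup x∉ (∈-lookup j) eq)
lookup-injective (x∉ ∷ _) (suc i) zero    eq = ⊥-elim (All.lookup x∉ (∈-lookup i) (sym eq))
lookup-injective (_ ∷ u)  (suc i) (suc j) eq = cong suc (lookup-injective u i j eq)

unique-length≤ : {n : ℕ} {xs : List (Fin n)} → Unique xs → length xs ≤ n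
unique-length≤ {n} {xs} u with length xs ≤? n
... | yes short = short
... | no long with pigeonhole (≰⇒> long) (lookup xs)
...   | i , j , i<j , same = ⊥-elim (<-irrefl (cong toℕ (lookup-injective u i j same)) i<j)

-- A pointwise R-correspondence between xs and a duplicate-free list ys labels
-- the positions of xs injectively by R-related elements; applied to the edges
-- of a path and their colours this is the injective colouring ψ.
injectiveLabelling : {A B : Set} {R : A → B → Set} {xs : List A} {ys : List B} →
  Pointwise R xs ys → Unique ys →
  Σ (Fin (length xs) → B) λ f → Injective _≡_ _≡_ f × (∀ j → R (lookup xs j) (f j))
injectiveLabelling {xs = xs} {ys} rel distinct = label , label-injective , Pointwise.lookup⁺ rel
  where
    position : Fin (length xs) → Fin (length ys)
    position = cast (Pointwise-length rel)

    label : Fin (length xs) → _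
    label j = lookup ys (position j)

    label-injective : Injective _≡_ _≡_ label
    label-injective {i} {j} same = toℕ-injective (begin
      toℕ i            ≡⟨ sym (toℕ-cast _ i) ⟩
      toℕ (position i) ≡⟨ cong toℕ (lookup-injective distinct _ _ same) ⟩
      toℕ (position j) ≡⟨ toℕ-cast _ j ⟩
      toℕ j            ∎)
      where open ≡-Reasoning

module Reachability (N : Network) {m : ℕ} (L : Fin m → DisjointFamily N) where
  open Network N
  open import Data.List.Membership.DecPropositional (_≟_ {n}) using (_∈?_)

  MulticolouredSTPath : Set
  MulticolouredSTPath = Σ (STPath N) (Multicolored N L)

  Colourable : V N × V N → Fin m → Set
  Colourable e c = InEdgeUnion N e (DisjointFamily.paths (L c))

  colourable⇒edge : ∀ {e c} → Colourable e c → E (proj₁ e) (proj₂ e)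
  colourable⇒edge (P , _ , e∈P) = All.lookup (STPath.isEdges P) e∈P

  colouring⇒edges : ∀ {es cs} → Pointwise Colourable es cs → All (λ e → E (proj₁ e) (proj₂ e)) es
  colouring⇒edges []         = []
  colouring⇒edges (ec ∷ ecs) = colourable⇒edge ec ∷ colouring⇒edges ecs

  inner≢s : (P : STPath N) {v : V N} → v ∈ STPath.inner P → v ≢ s
  inner≢s P v∈ v≡s with STPath.unique P
  ... | s∉ ∷ _ = All.lookup s∉ (∈-++⁺ˡ v∈) (sym v≡s)

  inner≢t : (P : STPath N) {v : V N} → v ∈ STPath.inner P → v ≢ t
  inner≢t P v∈ with STPath.unique P
  ... | _ ∷ u = init≢last u v∈

  record Walk (cl : List (Fin m)) (S : List (V N)) (u : V N) : Set where
    constructor walk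
    field
      mid      : List (V N)
      distinct : Unique (s ∷ mid ++ u ∷ [])
      colours  : List (Fin m)
      coloured : Pointwise Colourable (pairs (s ∷ mid ++ u ∷ [])) colours
      rainbow  : Unique colours
      allowed  : All (_∈ cl) colours
      inside   : All (_∈ S) (mid ++ u ∷ [])

  walk⇒multicoloured : ∀ {cl S} → Walk cl S t → MulticolouredSTPath
  walk⇒multicoloured (walk mid distinct _ coloured rainbow _ _) =
    stpath mid distinct (colouring⇒edges coloured) , injectiveLabelling coloured rainbow

  widen : ∀ {cl cl′ S S′ u} → cl ⊆ cl′ → S ⊆ S′ → Walk cl S u → Walk cl′ S′ u
  widen cl⊆ S⊆ (walk mid distinct colours coloured rainbow allowed inside) =
    walk mid distinct colours coloured rainbow (All.map cl⊆ allowed) (All.map S⊆ inside)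

  start : ∀ {cl S x} c → x ≢ s → Colourable (s , x) c → Walk (c ∷ cl) (x ∷ S) x
  start c x≢s sx =
    walk [] (((λ s≡x → x≢s (sym s≡x)) ∷ []) ∷ [] ∷ []) (c ∷ []) (sx ∷ []) ([] ∷ []) (here refl ∷ []) (here refl ∷ [])

  extend : ∀ {cl S p x} c → c ∉ cl → x ∉ S → x ≢ s → Colourable (p , x) c →
    Walk cl S p → Walk (c ∷ cl) (x ∷ S) x
  extend {p = p} {x} c c∉cl x∉S x≢s px (walk mid distinct colours coloured rainbow allowed inside) =
    walk (mid ++ p ∷ []) distinct′ (colours ++ c ∷ []) coloured′ rainbow′
         (AllP.++⁺ (All.map there allowed) (here refl ∷ []))
         (AllP.++⁺ (All.map there inside) (here refl ∷ []))
    where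
      x∉walk : x ∉ s ∷ mid ++ p ∷ []
      x∉walk (here x≡s) = x≢s x≡s
      x∉walk (there x∈) = x∉S (All.lookup inside x∈)

      distinct′ : Unique (s ∷ (mid ++ p ∷ []) ++ x ∷ [])
      distinct′ = UniqueP.++⁺ distinct ([] ∷ []) λ { (x∈ , here refl) → x∉walk x∈ }

      coloured′ : Pointwise Colourable (pairs (s ∷ (mid ++ p ∷ []) ++ x ∷ [])) (colours ++ c ∷ [])
      coloured′ = subst (λ es → Pointwise Colourable es (colours ++ c ∷ []))
                        (sym (pairs-∷ʳ (s ∷ mid) p x))
                        (Pointwise.++⁺ coloured (px ∷ []))

      rainbow′ : Unique (colours ++ c ∷ [])
      rainbow′ = UniqueP.++⁺ rainbow ([] ∷ []) λ { (c∈ , here refl) → c∉cl (All.lookup allowed c∈) }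

  Reached : List (V N) → V N → Set
  Reached S p = p ≡ s ⊎ p ∈ S

  step : ∀ {cl S p x} c → c ∉ cl → All (Walk cl S) S → Reached S p →
    x ∉ S → x ≢ s → Colourable (p , x) c → Walk (c ∷ cl) (x ∷ S) x
  step c c∉cl walks (inj₁ refl) x∉S x≢s px = start c x≢s px
  step c c∉cl walks (inj₂ p∈S)  x∉S x≢s px = extend c c∉cl x∉S x≢s px (All.lookup walks p∈S)

  size : Fin m → ℕ
  size c = length (DisjointFamily.paths (L c))

  record Progress (cl : List (Fin m)) : Set where
    field
      S       : List (V N)
      unique  : Unique S
      s∉S     : s ∉ S
      t∉S     : t ∉ S
      large   : sum (map size cl) ≤ length S
      reached : All (Walk cl S) S

  initial : Progress []
  initial = record { S = [] ; unique = [] ; s∉S = λ () ; t∉S = λ () ; large = z≤n ; reached = [] }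

  progress-bounded : ∀ {cl} (pr : Progress cl) → length (Progress.S pr) ≤ n ∸ 2
  progress-bounded pr =
    ∸-monoˡ-≤ 2 (unique-length≤ ((s≢t ∷ ¬Any⇒All¬ S s∉S) ∷ ¬Any⇒All¬ S t∉S ∷ unique))
    where open Progress pr

  module AddColour {cl : List (Fin m)} (pr : Progress cl) (c : Fin m) (c∉cl : c ∉ cl) where
    open Progress pr

    𝒫c : List (STPath N)
    𝒫c = DisjointFamily.paths (L c)

    record Discovery (P : STPath N) (x : V N) : Set where
      field
        onPath : x ∈ STPath.inner P
        fresh  : x ∉ S
        reach  : Walk (c ∷ cl) (x ∷ S) x

    scan : (P : STPath N) → P ∈ 𝒫c → (p : V N) → Reached S p → (xs : List (V N)) →
      pairs (p ∷ xs ++ t ∷ []) ⊆ edges N P → xs ⊆ STPath.inner P →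
      MulticolouredSTPath ⊎ ∃ (Discovery P)
    scan P P∈ p p-reached [] onP _ =
      inj₁ (walk⇒multicoloured (step c c∉cl reached p-reached t∉S (λ t≡s → s≢t (sym t≡s)) (P , P∈ , onP (here refl))))
    scan P P∈ p p-reached (x ∷ xs) onP inner with x ∈? S
    ... | yes x∈S = scan P P∈ x (inj₂ x∈S) xs (λ e∈ → onP (there e∈)) (λ y∈ → inner (there y∈))
    ... | no  x∉S = inj₂ (x , record
      { onPath = inner (here refl)
      ; fresh  = x∉S
      ; reach  = step c c∉cl reached p-reached x∉S (inner≢s P (inner (here refl))) (P , P∈ , onP (here refl))
      })

    scanPath : (P : STPath N) → P ∈ 𝒫c → MulticolouredSTPath ⊎ ∃ (Discovery P)
    scanPath P P∈ = scan P P∈ s (inj₁ refl) (STPath.inner P) (λ e∈ → e∈) (λ v∈ → v∈)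

    DiscoveredIn : List (STPath N) → V N → Set
    DiscoveredIn Ps x = ∃ λ P → P ∈ Ps × Discovery P x

    record Discoveries (Ps : List (STPath N)) : Set where
      field
        new         : List (V N)
        counted     : length new ≡ length Ps
        newUnique   : Unique new
        discovered  : All (DiscoveredIn Ps) new

    discoverAll : (Ps : List (STPath N)) → AllPairs (InnerlyDisjoint N) Ps → Ps ⊆ 𝒫c →
      MulticolouredSTPath ⊎ Discoveries Ps
    discoverAll [] _ _ = inj₂ (record { new = [] ; counted = refl ; newUnique = [] ; discovered = [] })
    discoverAll (P ∷ Ps) (P-disjoint ∷ Ps-disjoint) Ps⊆
      with scanPath P (Ps⊆ (here refl)) | discoverAll Ps Ps-disjoint (λ Q∈ → Ps⊆ (there Q∈))
    ... | inj₁ success | _            = inj₁ success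
    ... | inj₂ _       | inj₁ success = inj₁ success
    ... | inj₂ (x , dx) | inj₂ ds     = inj₂ (record
      { new        = x ∷ new
      ; counted    = cong suc counted
      ; newUnique  = All.map x≢ discovered ∷ newUnique
      ; discovered = (P , here refl , dx) ∷ All.map (λ { (Q , Q∈ , dy) → Q , there Q∈ , dy }) discovered
      })
      where
        open Discoveries ds
        x≢ : ∀ {y} → DiscoveredIn Ps y → x ≢ y
        x≢ (Q , Q∈ , dy) refl = All.lookup P-disjoint Q∈ x (Discovery.onPath dx) (Discovery.onPath dy)

    grow : Discoveries 𝒫c → Progress (c ∷ cl)
    grow ds = record
      { S       = new ++ S
      ; unique  = UniqueP.++⁺ newUnique unique λ { (x∈ , x∈S) → Discovery.fresh (at x∈) x∈S }
      ; s∉S     = avoids s (λ x∈ → inner≢s (path x∈) (Discovery.onPath (at x∈)) refl) s∉S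
      ; t∉S     = avoids t (λ x∈ → inner≢t (path x∈) (Discovery.onPath (at x∈)) refl) t∉S
      ; large   = ≤-trans (+-mono-≤ (≤-reflexive (sym counted)) large) (≤-reflexive (sym (length-++ new)))
      ; reached = AllP.++⁺ (All.tabulate (λ x∈ → widen (λ d → d) (into x∈) (Discovery.reach (at x∈))))
                           (All.map (widen there (∈-++⁺ʳ new)) reached)
      }
      where
        open Discoveries ds
        path : ∀ {x} → x ∈ new → STPath N
        path x∈ = proj₁ (All.lookup discovered x∈)
        at : ∀ {x} (x∈ : x ∈ new) → Discovery (path x∈) x
        at x∈ = proj₂ (proj₂ (All.lookup discovered x∈))
        avoids : ∀ v → v ∉ new → v ∉ S → v ∉ new ++ S
        avoids v v∉new v∉S v∈ with ∈-++⁻ new v∈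
        ... | inj₁ v∈new = v∉new v∈new
        ... | inj₂ v∈S   = v∉S v∈S
        into : ∀ {x} → x ∈ new → x ∷ S ⊆ new ++ S
        into x∈ (here refl) = ∈-++⁺ˡ x∈
        into x∈ (there y∈)  = ∈-++⁺ʳ new y∈

    addColour : MulticolouredSTPath ⊎ Progress (c ∷ cl)
    addColour with discoverAll 𝒫c (DisjointFamily.disjoint (L c)) (λ P∈ → P∈)
    ... | inj₁ success = inj₁ success
    ... | inj₂ ds      = inj₂ (grow ds)

  processColours : (cl : List (Fin m)) → Unique cl → MulticolouredSTPath ⊎ Progress cl
  processColours [] _ = inj₂ initial
  processColours (c ∷ cl) (c∉ ∷ cl-unique) with processColours cl cl-unique
  ... | inj₁ success = inj₁ success
  ... | inj₂ pr      = AddColour.addColour pr c (All¬⇒¬Any c∉)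

  -- Processing all colours must succeed, as otherwise |𝒫| ≤ |S| ≤ n - 2.
  theorem : n ∸ 2 < totalSize N L → MulticolouredSTPath
  theorem enough with processColours (allFin m) (UniqueP.allFin⁺ m)
  ... | inj₁ success = success
  ... | inj₂ pr      = ⊥-elim (<⇒≱ enough (≤-trans (Progress.large pr) (progress-bounded pr)))

corollary2p2 : (N : Network) (m : ℕ) (L : Fin m → DisjointFamily N) →
    Network.n N ∸ 2 < totalSize N L →
    Σ (STPath N) (λ Q → Multicolored N L Q)
corollary2p2 N m L = Reachability.theorem N L
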